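{- If $G$ is a digraph such that $V(G)$ can be partitioned into two dominating sets, then $\gamma(G\mathbin{\Box} C_4^{(0,2,0,2)})\le n(G)$.
   Context: All digraphs are finite, and their arc relation is irreflexive. $n(G)=|V(G)|$. A set $S\subseteq V(D)$ is dominating if every vertex not in $S$ is an out-neighbor of some vertex of $S$; $\gamma(D)$ is the minimum size of a dominating set. $C_4^{(0,2,0,2)}$ is the digraph with vertices $u,p,v,q$ and exactly the arcs $up,uq,vp,vq$ (an orientation of the 4-cycle $u,p,v,q$ in which $u$ and $v$ have out-degree 2). The Cartesian product $G\mathbin{\Box} H$ has vertex set $V(G)\times V(H)$, with an arc from $(g_1,h_1)$ to $(g_2,h_2)$ iff either $g_1=g_2$ and $h_1h_2\in A(H)$, or $h_1=h_2$ and $g_1g_2\in A(G)$. -}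

module Defs where

open import Data.Nat using (ℕ; _*_; _≤_)
open import Data.Fin using (Fin; zero; suc; remQuot)
open import Data.Fin.Subset using (Subset; _∈_; _∉_; ∣_∣)
open import Data.Product using (Σ; ∃; _×_; _,_; proj₁; proj₂)
open import Data.Sum using (_⊎_; inj₁; inj₂)
open import Data.Empty using (⊥)
open import Relation.Binary.PropositionalEquality using (_≡_)
open import Relation.Nullary using (¬_)

record Digraph : Set₁ where
  field
    n       : ℕ
    Arc     : Fin n → Fin n → Set
    irrefl  : ∀ v → ¬ Arc v v
open Digraph public

order : Digraph → ℕ
order = Digraph.n

Dominating : (D : Digraph) → Subset (n D) → Set
Dominating D S = ∀ v → v ∉ S → Σ (Fin (n D)) λ u → u ∈ S × Arc D u v

γ≤ : Digraph → ℕ → Set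
γ≤ D k = Σ (Subset (n D)) λ S → Dominating D S × ∣ S ∣ ≤ k

PartitionableInto2Dominating : Digraph → Set
PartitionableInto2Dominating D =
  Σ (Subset (n D)) λ S → Σ (Subset (n D)) λ T →
    Dominating D S × Dominating D T ×
    (∀ v → v ∈ S ⊎ v ∈ T) × (∀ v → v ∈ S → v ∈ T → ⊥)

-- C_4^{(0,2,0,2)}: vertices u=0, p=1, v=2, q=3; arcs up, uq, vp, vq.
data C4Arc : Fin 4 → Fin 4 → Set where
  u→p : C4Arc zero (suc zero)
  u→q : C4Arc zero (suc (suc (suc zero)))
  v→p : C4Arc (suc (suc zero)) (suc zero)
  v→q : C4Arc (suc (suc zero)) (suc (suc (suc zero)))

C4-irrefl : ∀ v → ¬ C4Arc v v
C4-irrefl _ ()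

C4-0202 : Digraph
C4-0202 = record { n = 4 ; Arc = C4Arc ; irrefl = C4-irrefl }

-- Cartesian product: vertex x : Fin (n G * n H) encodes the pair
-- (g , h) = remQuot x  (g : Fin (n G), h : Fin (n H)), a bijection.
□Arc : (G H : Digraph) → Fin (n G * n H) → Fin (n G * n H) → Set
□Arc G H x y =
  (g₁ ≡ g₂ × Arc H h₁ h₂) ⊎ (h₁ ≡ h₂ × Arc G g₁ g₂)
  where
    g₁ = proj₁ (remQuot {n G} (n H) x)
    h₁ = proj₂ (remQuot {n G} (n H) x)
    g₂ = proj₁ (remQuot {n G} (n H) y)
    h₂ = proj₂ (remQuot {n G} (n H) y)

□-irrefl : (G H : Digraph) → ∀ x → ¬ □Arc G H x x
□-irrefl G H x (inj₁ (_ , a)) = irrefl H _ a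
□-irrefl G H x (inj₂ (_ , a)) = irrefl G _ a

_□_ : Digraph → Digraph → Digraph
G □ H = record { n = n G * n H ; Arc = □Arc G H ; irrefl = □-irrefl G H }

module Submission where

-- Put S in the layer G × {u} and T in the layer G × {v}.  Each layer
-- dominates its own copy of G because S and T dominate G, and a vertex
-- (g, p) or (g, q) is dominated from (g, u) if g ∈ S and from (g, v) if
-- g ∈ T.  Since S and T are disjoint the set has |S| + |T| ≤ n(G) vertices.

open import Defs
open import Data.Bool using (true; false; _∧_)
open import Data.Nat using (zero; suc; _+_; _*_; _≤_; z≤n; s≤s)
open import Data.Nat.Properties using (≤-reflexive; ≤-trans; m≤n⇒m≤1+n; +-suc; *-identityʳ; module ≤-Reasoning)
open import Data.Fin using (Fin; zero; suc; combine)
open import Data.Fin.Properties using (remQuot-combine; combine-remQuot)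
open import Data.Fin.Subset using (Subset; inside; outside; _∈_; _∉_; _⊆_; _∪_; ⁅_⁆; ∣_∣)
open import Data.Fin.Subset.Properties using (x∈⁅x⁆; ∣⁅x⁆∣≡1; ∣⊥∣≡0; p⊆p∪q; q⊆p∪q)
open import Data.Vec using ([]; _∷_; _++_; map; lookup; _⊛*_; here; there)
open import Data.Vec.Properties using ([]=⇒lookup; lookup⇒[]=; lookup-⊛*; lookup-map; map-id; map-const)
open import Data.Product using (Σ; _×_; _,_; proj₁; proj₂)
open import Data.Sum using (_⊎_; inj₁; inj₂)
open import Data.Empty using (⊥; ⊥-elim)
open import Relation.Binary.PropositionalEquality using (_≡_; refl; cong; cong₂; subst₂; sym; trans; subst; module ≡-Reasoning)

∣p++q∣≡∣p∣+∣q∣ : ∀ {m k} (p : Subset m) (q : Subset k) → ∣ p ++ q ∣ ≡ ∣ p ∣ + ∣ q ∣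
∣p++q∣≡∣p∣+∣q∣ []            q = refl
∣p++q∣≡∣p∣+∣q∣ (inside  ∷ p) q = cong suc (∣p++q∣≡∣p∣+∣q∣ p q)
∣p++q∣≡∣p∣+∣q∣ (outside ∷ p) q = ∣p++q∣≡∣p∣+∣q∣ p q

∣p∪q∣≤∣p∣+∣q∣ : ∀ {m} (p q : Subset m) → ∣ p ∪ q ∣ ≤ ∣ p ∣ + ∣ q ∣
∣p∪q∣≤∣p∣+∣q∣ []            []            = z≤n
∣p∪q∣≤∣p∣+∣q∣ (inside  ∷ p) (inside  ∷ q) = s≤s (≤-trans (m≤n⇒m≤1+n (∣p∪q∣≤∣p∣+∣q∣ p q)) (≤-reflexive (sym (+-suc ∣ p ∣ ∣ q ∣))))
∣p∪q∣≤∣p∣+∣q∣ (inside  ∷ p) (outside ∷ q) = s≤s (∣p∪q∣≤∣p∣+∣q∣ p q)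
∣p∪q∣≤∣p∣+∣q∣ (outside ∷ p) (inside  ∷ q) = ≤-trans (s≤s (∣p∪q∣≤∣p∣+∣q∣ p q)) (≤-reflexive (sym (+-suc ∣ p ∣ ∣ q ∣)))
∣p∪q∣≤∣p∣+∣q∣ (outside ∷ p) (outside ∷ q) = ∣p∪q∣≤∣p∣+∣q∣ p q

Disjoint : ∀ {m} → Subset m → Subset m → Set
Disjoint p q = ∀ x → x ∈ p → x ∈ q → ⊥

Disjoint-tail : ∀ {m s t} {p q : Subset m} → Disjoint (s ∷ p) (t ∷ q) → Disjoint p q
Disjoint-tail disjoint x x∈p x∈q = disjoint (suc x) (there x∈p) (there x∈q)

Disjoint⇒∣p∣+∣q∣≤n : ∀ {m} (p q : Subset m) → Disjoint p q → ∣ p ∣ + ∣ q ∣ ≤ m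
Disjoint⇒∣p∣+∣q∣≤n []            []            _        = z≤n
Disjoint⇒∣p∣+∣q∣≤n (inside  ∷ p) (inside  ∷ q) disjoint = ⊥-elim (disjoint zero here here)
Disjoint⇒∣p∣+∣q∣≤n (inside  ∷ p) (outside ∷ q) disjoint = s≤s (Disjoint⇒∣p∣+∣q∣≤n p q (Disjoint-tail disjoint))
Disjoint⇒∣p∣+∣q∣≤n (outside ∷ p) (inside  ∷ q) disjoint =
  ≤-trans (≤-reflexive (+-suc ∣ p ∣ ∣ q ∣)) (s≤s (Disjoint⇒∣p∣+∣q∣≤n p q (Disjoint-tail disjoint)))
Disjoint⇒∣p∣+∣q∣≤n (outside ∷ p) (outside ∷ q) disjoint = m≤n⇒m≤1+n (Disjoint⇒∣p∣+∣q∣≤n p q (Disjoint-tail disjoint))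

infixr 7 _⊗_

_⊗_ : ∀ {m k} → Subset m → Subset k → Subset (m * k)
p ⊗ q = map _∧_ p ⊛* q

combine∈p⊗q : ∀ {m k} {p : Subset m} {q : Subset k} {x y} → x ∈ p → y ∈ q → combine x y ∈ p ⊗ q
combine∈p⊗q {p = p} {q} {x} {y} x∈p y∈q = lookup⇒[]= (combine x y) (p ⊗ q) (begin
  lookup (p ⊗ q) (combine x y)         ≡⟨ lookup-⊛* (map _∧_ p) q x y ⟩
  lookup (map _∧_ p) x (lookup q y)    ≡⟨ cong (λ f → f (lookup q y)) (lookup-map x _∧_ p) ⟩
  lookup p x ∧ lookup q y              ≡⟨ cong₂ _∧_ ([]=⇒lookup x∈p) ([]=⇒lookup y∈q) ⟩
  true                                 ∎)
  where open ≡-Reasoning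

∣p⊗q∣≡∣p∣*∣q∣ : ∀ {m k} (p : Subset m) (q : Subset k) → ∣ p ⊗ q ∣ ≡ ∣ p ∣ * ∣ q ∣
∣p⊗q∣≡∣p∣*∣q∣ [] q = refl
∣p⊗q∣≡∣p∣*∣q∣ (inside ∷ p) q = begin
  ∣ map (true ∧_) q ++ p ⊗ q ∣       ≡⟨ ∣p++q∣≡∣p∣+∣q∣ (map (true ∧_) q) (p ⊗ q) ⟩
  ∣ map (true ∧_) q ∣ + ∣ p ⊗ q ∣    ≡⟨ cong₂ _+_ (cong ∣_∣ (map-id q)) (∣p⊗q∣≡∣p∣*∣q∣ p q) ⟩
  ∣ q ∣ + ∣ p ∣ * ∣ q ∣              ∎
  where open ≡-Reasoning
∣p⊗q∣≡∣p∣*∣q∣ {k = k} (outside ∷ p) q = begin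
  ∣ map (false ∧_) q ++ p ⊗ q ∣      ≡⟨ ∣p++q∣≡∣p∣+∣q∣ (map (false ∧_) q) (p ⊗ q) ⟩
  ∣ map (false ∧_) q ∣ + ∣ p ⊗ q ∣   ≡⟨ cong₂ _+_ (trans (cong ∣_∣ (map-const q false)) (∣⊥∣≡0 k)) (∣p⊗q∣≡∣p∣*∣q∣ p q) ⟩
  ∣ p ∣ * ∣ q ∣                      ∎
  where open ≡-Reasoning

∣p⊗⁅x⁆∣≡∣p∣ : ∀ {m k} (p : Subset m) (x : Fin k) → ∣ p ⊗ ⁅ x ⁆ ∣ ≡ ∣ p ∣
∣p⊗⁅x⁆∣≡∣p∣ p x = begin
  ∣ p ⊗ ⁅ x ⁆ ∣        ≡⟨ ∣p⊗q∣≡∣p∣*∣q∣ p ⁅ x ⁆ ⟩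
  ∣ p ∣ * ∣ ⁅ x ⁆ ∣    ≡⟨ cong (∣ p ∣ *_) (∣⁅x⁆∣≡1 x) ⟩
  ∣ p ∣ * 1            ≡⟨ *-identityʳ ∣ p ∣ ⟩
  ∣ p ∣                ∎
  where open ≡-Reasoning

∣p⊗⁅x⁆∪q⊗⁅y⁆∣≤m : ∀ {m k} (p q : Subset m) (x y : Fin k) → Disjoint p q → ∣ p ⊗ ⁅ x ⁆ ∪ q ⊗ ⁅ y ⁆ ∣ ≤ m
∣p⊗⁅x⁆∪q⊗⁅y⁆∣≤m {m} p q x y disjoint = begin
  ∣ p ⊗ ⁅ x ⁆ ∪ q ⊗ ⁅ y ⁆ ∣          ≤⟨ ∣p∪q∣≤∣p∣+∣q∣ (p ⊗ ⁅ x ⁆) (q ⊗ ⁅ y ⁆) ⟩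
  ∣ p ⊗ ⁅ x ⁆ ∣ + ∣ q ⊗ ⁅ y ⁆ ∣      ≡⟨ cong₂ _+_ (∣p⊗⁅x⁆∣≡∣p∣ p x) (∣p⊗⁅x⁆∣≡∣p∣ q y) ⟩
  ∣ p ∣ + ∣ q ∣                      ≤⟨ Disjoint⇒∣p∣+∣q∣≤n p q disjoint ⟩
  m                                  ∎
  where open ≤-Reasoning

DominatedBy : (D : Digraph) → Subset (n D) → Fin (n D) → Set
DominatedBy D S v = v ∉ S → Σ (Fin (n D)) λ u → u ∈ S × Arc D u v

module _ (G H : Digraph) where

  vertex : Fin (n G) → Fin (n H) → Fin (n (G □ H))
  vertex = combine

  PairArc : Fin (n G) × Fin (n H) → Fin (n G) × Fin (n H) → Set
  PairArc (g₁ , h₁) (g₂ , h₂) = (g₁ ≡ g₂ × Arc H h₁ h₂) ⊎ (h₁ ≡ h₂ × Arc G g₁ g₂)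

  □Arc-vertex : ∀ {g₁ g₂ h₁ h₂} → PairArc (g₁ , h₁) (g₂ , h₂) → □Arc G H (vertex g₁ h₁) (vertex g₂ h₂)
  □Arc-vertex {g₁} {g₂} {h₁} {h₂} =
    subst₂ (λ x y → PairArc (proj₁ x , proj₂ x) (proj₁ y , proj₂ y))
           (sym (remQuot-combine g₁ h₁)) (sym (remQuot-combine g₂ h₂))

  dominating-pointwise : ∀ {D} → (∀ g h → DominatedBy (G □ H) D (vertex g h)) → Dominating (G □ H) D
  dominating-pointwise {D} dominated x = subst (DominatedBy (G □ H) D) (combine-remQuot {n G} (n H) x) (dominated _ _)

  dominatedBy-layer : ∀ {S D h} g → Dominating G S → S ⊗ ⁅ h ⁆ ⊆ D → DominatedBy (G □ H) D (vertex g h)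
  dominatedBy-layer {h = h} g S-dom S⊗h⊆D gh∉D
    with S-dom g (λ g∈S → gh∉D (S⊗h⊆D (combine∈p⊗q g∈S (x∈⁅x⁆ h))))
  ... | u , u∈S , arc = vertex u h , S⊗h⊆D (combine∈p⊗q u∈S (x∈⁅x⁆ h)) , □Arc-vertex (inj₂ (refl , arc))

  dominatedBy-fibre : ∀ {S D g h₀ h} → g ∈ S → Arc H h₀ h → S ⊗ ⁅ h₀ ⁆ ⊆ D → DominatedBy (G □ H) D (vertex g h)
  dominatedBy-fibre {g = g} {h₀} g∈S arc S⊗h₀⊆D _ =
    vertex g h₀ , S⊗h₀⊆D (combine∈p⊗q g∈S (x∈⁅x⁆ h₀)) , □Arc-vertex (inj₁ (refl , arc))

lemma7p1 : (G : Digraph) → PartitionableInto2Dominating G → γ≤ (G □ C4-0202) (order G)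
lemma7p1 G (S , T , S-dom , T-dom , cover , disjoint) = D , D-dom , ∣p⊗⁅x⁆∪q⊗⁅y⁆∣≤m S T u v disjoint
  where
  u v : Fin 4
  u = zero
  v = suc (suc zero)

  D : Subset (n G * 4)
  D = S ⊗ ⁅ u ⁆ ∪ T ⊗ ⁅ v ⁆

  dominatedBy-u-or-v : ∀ {h} g → C4Arc u h → C4Arc v h → DominatedBy (G □ C4-0202) D (vertex G C4-0202 g h)
  dominatedBy-u-or-v g u→h v→h with cover g
  ... | inj₁ g∈S = dominatedBy-fibre G C4-0202 g∈S u→h (p⊆p∪q _)
  ... | inj₂ g∈T = dominatedBy-fibre G C4-0202 g∈T v→h (q⊆p∪q _ _)

  D-dom : Dominating (G □ C4-0202) D
  D-dom = dominating-pointwise G C4-0202 λ where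
    g zero                    → dominatedBy-layer G C4-0202 g S-dom (p⊆p∪q _)
    g (suc zero)              → dominatedBy-u-or-v g u→p v→p
    g (suc (suc zero))        → dominatedBy-layer G C4-0202 g T-dom (q⊆p∪q _ _)
    g (suc (suc (suc zero)))  → dominatedBy-u-or-v g u→q v→q
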